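{- For a permutation $\tau$, let $t_\tau$ denote its number of non-left-to-right-maxima. Let $\sigma$ and $\pi$ be two permutations of $\{1,\dots,n\}$. Then $t_{\sigma^{ -1}\cdot\pi}$ right-jumps are necessary to obtain $\pi$ from $\sigma$ by a sequence of right-jumps. In particular, $t_{\sigma^{ -1}}$ right-jumps are necessary and sufficient to transform $\sigma$ into the identity permutation by right-jumps (i.e. to sort $\sigma$ by insertion).
   Context: Permutations are written in one-line notation $\sigma=\sigma_1\cdots\sigma_n$, and $\gamma\cdot\alpha$ denotes the composition $\gamma\circ\alpha$, i.e. the permutation $\gamma(\alpha_1)\gamma(\alpha_2)\cdots\gamma(\alpha_n)$. A right-jump transforms $\sigma$ into $\sigma_1\cdots\sigma_{i-1}\sigma_{i+1}\cdots\sigma_j\,\sigma_i\,\sigma_{j+1}\cdots\sigma_n$ for some $1\le i<j\le n$. A left-to-right maximum of $\sigma$ is a value $\sigma_i$ with $\sigma_k\le\sigma_i$ for all $k\le i$; other values are non-left-to-right-maxima. -}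

module Defs where

open import Data.Nat using (ℕ; zero; suc; _+_)
open import Data.Fin using (Fin; _≤?_)
open import Data.Fin.Permutation using (Permutation′; _⟨$⟩ʳ_; _∘ₚ_)
open import Data.List using (List; []; _∷_; _++_; [_]; tabulate)
open import Data.List.Relation.Unary.All using (all?)
open import Data.Product using (∃; ∃-syntax; _×_)
open import Relation.Binary.PropositionalEquality using (_≡_)
open import Relation.Nullary using (yes; no)

-- One-line notation σ₁ ⋯ σₙ of a permutation of Fin n (Fin n = {1,…,n}, 0-based).
oneLine : ∀ {n} → Permutation′ n → List (Fin n)
oneLine σ = tabulate (σ ⟨$⟩ʳ_)

-- γ · α = γ ∘ α, i.e. one-line γ(α₁)⋯γ(αₙ).  (stdlib's _∘ₚ_ is diagrammatic.)
_·_ : ∀ {n} → Permutation′ n → Permutation′ n → Permutation′ n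
γ · α = α ∘ₚ γ

nonLTRFrom : ∀ {n} → List (Fin n) → List (Fin n) → ℕ
nonLTRFrom pre [] = 0
nonLTRFrom pre (x ∷ xs) with all? (_≤? x) pre
... | yes _ = nonLTRFrom (x ∷ pre) xs
... | no  _ = suc (nonLTRFrom (x ∷ pre) xs)

t : ∀ {n} → Permutation′ n → ℕ
t τ = nonLTRFrom [] (oneLine τ)

-- A right-jump: σ = a ++ [σᵢ] ++ b ++ c with b = σᵢ₊₁⋯σⱼ non-empty (i < j),
-- becomes a ++ b ++ [σᵢ] ++ c.
RightJump : ∀ {n} → List (Fin n) → List (Fin n) → Set
RightJump xs ys =
  ∃[ a ] ∃[ x ] ∃[ y ] ∃[ b ] ∃[ c ]
    (xs ≡ a ++ [ x ] ++ (y ∷ b) ++ c) × (ys ≡ a ++ (y ∷ b) ++ [ x ] ++ c)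

data Jumps {n} : ℕ → List (Fin n) → List (Fin n) → Set where
  done : ∀ {xs} → Jumps zero xs xs
  step : ∀ {m xs ys zs} → RightJump xs ys → Jumps m ys zs → Jumps (suc m) xs zs

-- A right-jump moves one entry x past a block of later entries. The entries of that
-- block lose x as a predecessor and those after it keep the same set of predecessors,
-- so only x itself can turn into a non-left-to-right-maximum: the number of
-- non-left-to-right-maxima grows by at most one per jump. Relabelling values by σ⁻¹
-- commutes with jumps and turns σ into the identity, which has none; this gives the
-- lower bound t_{σ⁻¹·π}. Conversely insertion sort of σ⁻¹ attains the bound: reading
-- σ⁻¹ from left to right, each new entry z is inserted into the sorted list of the
-- entries before it, and this costs one right-jump (moving z to the end) exactly when
-- z is not a left-to-right maximum. Relabelling by σ turns this into a sorting of σ.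
module Submission where

open import Defs
open import Data.Nat using (ℕ; _≤_)
open import Data.Fin.Permutation using (Permutation′; flip; id)
open import Data.Product using (_×_)

open import Data.Nat using (suc; _+_; z≤n; s≤s)
open import Data.Nat.Properties
  using (≤-refl; ≤-trans; ≤-reflexive; n≤1+n; m≤n⇒m≤1+n; <⇒≤; <⇒≱; ≰⇒>;
         +-mono-≤; +-monoˡ-≤; +-monoʳ-≤; +-suc; +-comm; +-identityʳ; module ≤-Reasoning)
open import Data.Fin as Fin using (Fin; _<_; _≤?_; _≟_)
open import Data.Fin.Properties using (<-irrefl; <-asym)
open import Data.Fin.Permutation using (_⟨$⟩ʳ_; _⟨$⟩ˡ_; inverseˡ; inverseʳ)
open import Data.List
  using (List; []; _∷_; _++_; [_]; _∷ʳ_; _ʳ++_; map; filter; reverse; allFin)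
open import Data.List.Properties
  using (++-assoc; ++-identityʳ; map-++; map-tabulate; tabulate-cong;
         filter-++; filter-accept; filter-reject; filter-none; filter-all)
open import Data.List.Membership.Propositional using (_∈_; _∉_; find)
open import Data.List.Membership.Propositional.Properties
  using (∈-++⁺ˡ; ∈-++⁺ʳ; ∈-++⁻; ∈-∃++; ∈-allFin; ∈-filter⁺; ∈-filter⁻; ∈-tabulate⁺)
import Data.List.Membership.DecPropositional as DecMembership
open import Data.List.Relation.Unary.Any using (here; there)
import Data.List.Relation.Unary.Any.Properties as Any
open import Data.List.Relation.Unary.All as All using (All; []; _∷_; all?)
import Data.List.Relation.Unary.All.Properties as All
open import Data.List.Relation.Unary.AllPairs using (AllPairs; []; _∷_)
import Data.List.Relation.Unary.AllPairs as AllPairs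
import Data.List.Relation.Unary.AllPairs.Properties as AllPairs
open import Data.List.Relation.Unary.Unique.Propositional using (Unique)
import Data.List.Relation.Unary.Unique.Propositional.Properties as Unique
open import Data.List.Relation.Binary.Subset.Propositional using (_⊆_)
open import Data.List.Relation.Binary.Subset.Propositional.Properties
  using (⊆-reflexive-↭; xs⊆x∷xs; ∷⁺ʳ)
open import Data.List.Relation.Binary.Permutation.Propositional
  using (↭-sym; ↭-trans; prep)
open import Data.List.Relation.Binary.Permutation.Propositional.Properties
  using (shift; ++↭ʳ++)
open import Data.List.Reverse using (Reverse; []; _∶_∶ʳ_; reverseView)
open import Data.Product using (∃₂; _,_)
open import Data.Sum using (inj₁; inj₂)
open import Data.Empty using (⊥-elim)
open import Function using (_∘_)
open import Relation.Nullary using (yes; no)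
open import Relation.Binary.PropositionalEquality
  using (_≡_; refl; sym; trans; cong; cong₂; subst; subst₂; module ≡-Reasoning)

AllPairs-++⁻ : ∀ {a ℓ} {A : Set a} {R : A → A → Set ℓ} xs {ys : List A} → AllPairs R (xs ++ ys) →
               AllPairs R xs × AllPairs R ys × All (λ x → All (R x) ys) xs
AllPairs-++⁻ []       xs↗        = [] , xs↗ , []
AllPairs-++⁻ (x ∷ xs) (x≺ ∷ xs↗) with xs↗′ , ys↗ , xs≺ys ← AllPairs-++⁻ xs xs↗ =
  All.++⁻ˡ xs x≺ ∷ xs↗′ , ys↗ , All.++⁻ʳ xs x≺ ∷ xs≺ys

nonLTR : ∀ {n} → List (Fin n) → ℕ
nonLTR = nonLTRFrom []

module _ {n : ℕ} where

  nonLTRFrom-++ : ∀ (pre xs ys : List (Fin n)) →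
                  nonLTRFrom pre (xs ++ ys) ≡ nonLTRFrom pre xs + nonLTRFrom (xs ʳ++ pre) ys
  nonLTRFrom-++ pre []       ys = refl
  nonLTRFrom-++ pre (x ∷ xs) ys with all? (_≤? x) pre
  ... | yes _ = nonLTRFrom-++ (x ∷ pre) xs ys
  ... | no  _ = cong suc (nonLTRFrom-++ (x ∷ pre) xs ys)

  nonLTRFrom-mono : ∀ {pre pre′ : List (Fin n)} → pre′ ⊆ pre →
                    ∀ xs → nonLTRFrom pre′ xs ≤ nonLTRFrom pre xs
  nonLTRFrom-mono sub [] = z≤n
  nonLTRFrom-mono {pre} {pre′} sub (x ∷ xs) with all? (_≤? x) pre | all? (_≤? x) pre′
  ... | yes _     | yes _     = nonLTRFrom-mono (∷⁺ʳ x sub) xs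
  ... | yes pre≤x | no pre′≰x = ⊥-elim (pre′≰x (All.tabulate (All.lookup pre≤x ∘ sub)))
  ... | no  _     | yes _     = m≤n⇒m≤1+n (nonLTRFrom-mono (∷⁺ʳ x sub) xs)
  ... | no  _     | no  _     = s≤s (nonLTRFrom-mono (∷⁺ʳ x sub) xs)

  nonLTRFrom-∷-lower : ∀ (pre : List (Fin n)) x xs →
                       nonLTRFrom (x ∷ pre) xs ≤ nonLTRFrom pre (x ∷ xs)
  nonLTRFrom-∷-lower pre x xs with all? (_≤? x) pre
  ... | yes _ = ≤-refl
  ... | no  _ = n≤1+n _

  nonLTRFrom-∷-upper : ∀ (pre : List (Fin n)) x xs →
                       nonLTRFrom pre (x ∷ xs) ≤ suc (nonLTRFrom (x ∷ pre) xs)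
  nonLTRFrom-∷-upper pre x xs with all? (_≤? x) pre
  ... | yes _ = n≤1+n _
  ... | no  _ = ≤-refl

  ∷-ʳ++-⊆ : ∀ x (xs pre : List (Fin n)) → x ∷ (xs ʳ++ pre) ⊆ xs ʳ++ (x ∷ pre)
  ∷-ʳ++-⊆ x xs pre = ⊆-reflexive-↭ (↭-trans (prep x (↭-sym (++↭ʳ++ xs pre)))
                       (↭-trans (↭-sym (shift x xs pre)) (++↭ʳ++ xs (x ∷ pre))))

  nonLTRFrom-moveRight : ∀ (pre xs ys : List (Fin n)) x →
    nonLTRFrom pre (xs ++ x ∷ ys) ≤ suc (nonLTRFrom pre (x ∷ xs ++ ys))
  nonLTRFrom-moveRight pre xs ys x = begin
    N pre (xs ++ x ∷ ys)                              ≡⟨ nonLTRFrom-++ pre xs (x ∷ ys) ⟩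
    N pre xs + N (xs ʳ++ pre) (x ∷ ys)                ≤⟨ +-mono-≤ (nonLTRFrom-mono (xs⊆x∷xs pre x) xs)
                                                                  (nonLTRFrom-∷-upper (xs ʳ++ pre) x ys) ⟩
    N (x ∷ pre) xs + suc (N (x ∷ (xs ʳ++ pre)) ys)    ≤⟨ +-monoʳ-≤ (N (x ∷ pre) xs)
                                                           (s≤s (nonLTRFrom-mono (∷-ʳ++-⊆ x xs pre) ys)) ⟩
    N (x ∷ pre) xs + suc (N (xs ʳ++ (x ∷ pre)) ys)    ≡⟨ +-suc _ _ ⟩
    suc (N (x ∷ pre) xs + N (xs ʳ++ (x ∷ pre)) ys)    ≡⟨ cong suc (nonLTRFrom-++ (x ∷ pre) xs ys) ⟨
    suc (N (x ∷ pre) (xs ++ ys))                      ≤⟨ s≤s (nonLTRFrom-∷-lower pre x (xs ++ ys)) ⟩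
    suc (N pre (x ∷ xs ++ ys))                        ∎
    where
      open ≤-Reasoning
      N = nonLTRFrom

  nonLTR-RightJump : ∀ {xs ys : List (Fin n)} → RightJump xs ys → nonLTR ys ≤ suc (nonLTR xs)
  nonLTR-RightJump (a , x , y , b , c , refl , refl) = begin
    nonLTR (a ++ (y ∷ b) ++ x ∷ c)                            ≡⟨ nonLTRFrom-++ [] a _ ⟩
    nonLTR a + nonLTRFrom (reverse a) ((y ∷ b) ++ x ∷ c)      ≤⟨ +-monoʳ-≤ (nonLTR a)
                                                     (nonLTRFrom-moveRight (reverse a) (y ∷ b) c x) ⟩
    nonLTR a + suc (nonLTRFrom (reverse a) (x ∷ y ∷ b ++ c))  ≡⟨ +-suc _ _ ⟩
    suc (nonLTR a + nonLTRFrom (reverse a) (x ∷ y ∷ b ++ c))  ≡⟨ cong suc (nonLTRFrom-++ [] a _) ⟨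
    suc (nonLTR (a ++ x ∷ y ∷ b ++ c))                        ∎
    where open ≤-Reasoning

  nonLTR-Jumps : ∀ {m} {xs ys : List (Fin n)} → Jumps m xs ys → nonLTR ys ≤ nonLTR xs + m
  nonLTR-Jumps {xs = xs} done = ≤-reflexive (sym (+-identityʳ (nonLTR xs)))
  nonLTR-Jumps {suc m} {xs} {zs} (step {ys = ys} j js) = begin
    nonLTR zs           ≤⟨ nonLTR-Jumps js ⟩
    nonLTR ys + m       ≤⟨ +-monoˡ-≤ m (nonLTR-RightJump j) ⟩
    suc (nonLTR xs) + m ≡⟨ +-suc (nonLTR xs) m ⟨
    nonLTR xs + suc m   ∎
    where open ≤-Reasoning

  nonLTRFrom-sorted : ∀ {pre xs : List (Fin n)} → AllPairs Fin._≤_ xs →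
                      All (λ p → All (p Fin.≤_) xs) pre → nonLTRFrom pre xs ≡ 0
  nonLTRFrom-sorted {xs = []}     _          _   = refl
  nonLTRFrom-sorted {pre} {x ∷ xs} (x≤ ∷ xs↗) pre≤ with all? (_≤? x) pre
  ... | yes _   = nonLTRFrom-sorted xs↗ (x≤ ∷ All.map All.tail pre≤)
  ... | no  pre≰ = ⊥-elim (pre≰ (All.map All.head pre≤))

  allFin-strictlySorted : AllPairs _<_ (allFin n)
  allFin-strictlySorted = AllPairs.tabulate⁺-< (λ i<j → i<j)

  nonLTR-allFin : nonLTR (allFin n) ≡ 0
  nonLTR-allFin = nonLTRFrom-sorted (AllPairs.map <⇒≤ allFin-strictlySorted) []

RightJump-map : ∀ {m n} (f : Fin m → Fin n) {xs ys} →
                RightJump xs ys → RightJump (map f xs) (map f ys)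
RightJump-map f (a , x , y , b , c , refl , refl) =
  map f a , f x , f y , map f b , map f c ,
  trans (map-++ f a _) (cong (λ r → map f a ++ f x ∷ f y ∷ r) (map-++ f b c)) ,
  trans (map-++ f a _) (cong (λ r → map f a ++ f y ∷ r) (map-++ f b (x ∷ c)))

Jumps-map : ∀ {m n k} (f : Fin m → Fin n) {xs ys} → Jumps k xs ys → Jumps k (map f xs) (map f ys)
Jumps-map f done        = done
Jumps-map f (step j js) = step (RightJump-map f j) (Jumps-map f js)

oneLine-· : ∀ {n} (γ α : Permutation′ n) → oneLine (γ · α) ≡ map (γ ⟨$⟩ʳ_) (oneLine α)
oneLine-· γ α = sym (map-tabulate (α ⟨$⟩ʳ_) (γ ⟨$⟩ʳ_))

Jumps-· : ∀ {n k} (γ : Permutation′ n) {α β} →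
          Jumps k (oneLine α) (oneLine β) → Jumps k (oneLine (γ · α)) (oneLine (γ · β))
Jumps-· γ {α} {β} js = subst₂ (Jumps _) (sym (oneLine-· γ α)) (sym (oneLine-· γ β))
                         (Jumps-map (γ ⟨$⟩ʳ_) js)

oneLine-flip-· : ∀ {n} (σ : Permutation′ n) → oneLine (flip σ · σ) ≡ allFin n
oneLine-flip-· σ = tabulate-cong (λ _ → inverseˡ σ)

oneLine-·-flip : ∀ {n} (σ : Permutation′ n) → oneLine (σ · flip σ) ≡ allFin n
oneLine-·-flip σ = tabulate-cong (λ _ → inverseʳ σ)

t-lowerBound : ∀ {n m} (σ π : Permutation′ n) →
               Jumps m (oneLine σ) (oneLine π) → t (flip σ · π) ≤ m
t-lowerBound {n} {m} σ π js =
  ≤-trans (nonLTR-Jumps fromIdentity) (≤-reflexive (cong (_+ m) (nonLTR-allFin {n})))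
  where
    fromIdentity : Jumps m (allFin n) (oneLine (flip σ · π))
    fromIdentity = subst (λ l → Jumps m l (oneLine (flip σ · π))) (oneLine-flip-· σ)
                         (Jumps-· (flip σ) {σ} {π} js)

RightJump-++ʳ : ∀ {n} {xs ys : List (Fin n)} zs → RightJump xs ys → RightJump (xs ++ zs) (ys ++ zs)
RightJump-++ʳ zs (a , x , y , b , c , refl , refl) =
  a , x , y , b , c ++ zs ,
  trans (++-assoc a _ zs) (cong (λ r → a ++ x ∷ y ∷ r) (++-assoc b c zs)) ,
  trans (++-assoc a _ zs) (cong (λ r → a ++ y ∷ r) (++-assoc b (x ∷ c) zs))

Jumps-++ʳ : ∀ {n k} {xs ys : List (Fin n)} zs → Jumps k xs ys → Jumps k (xs ++ zs) (ys ++ zs)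
Jumps-++ʳ zs done        = done
Jumps-++ʳ zs (step j js) = step (RightJump-++ʳ zs j) (Jumps-++ʳ zs js)

_◅◅_ : ∀ {n k l} {xs ys zs : List (Fin n)} → Jumps k xs ys → Jumps l ys zs → Jumps (k + l) xs zs
done      ◅◅ js′ = js′
step j js ◅◅ js′ = step j (js ◅◅ js′)

RightJump-toEnd : ∀ {n} (a : List (Fin n)) x y b → RightJump (a ++ x ∷ y ∷ b) ((a ++ y ∷ b) ∷ʳ x)
RightJump-toEnd a x y b =
  a , x , y , b , [] , cong (λ r → a ++ x ∷ y ∷ r) (sym (++-identityʳ b)) , ++-assoc a (y ∷ b) [ x ]

module _ {n : ℕ} where

  open DecMembership (_≟_ {n}) using (_∈?_)

  -- Filtering allFin n forgets multiplicities: this sorts lists without repetitions only.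
  sort : List (Fin n) → List (Fin n)
  sort xs = filter (_∈? xs) (allFin n)

  allFin-splitAt : ∀ z → ∃₂ λ below above →
    allFin n ≡ below ++ z ∷ above × All (_< z) below × All (z <_) above
  allFin-splitAt z with below , above , eq ← ∈-∃++ (∈-allFin z)
    with _ , z<above ∷ _ , below<z∷above
           ← AllPairs-++⁻ below (subst (AllPairs _<_) eq allFin-strictlySorted) =
    below , above , eq , All.map All.head below<z∷above , z<above

  filter-∈?-∷ʳ-fresh : ∀ {z} (ys xs : List (Fin n)) → z ∉ xs →
                       filter (_∈? ys ∷ʳ z) xs ≡ filter (_∈? ys) xs
  filter-∈?-∷ʳ-fresh ys []       z∉ = refl
  filter-∈?-∷ʳ-fresh {z} ys (x ∷ xs) z∉ with x ∈? ys
  ... | yes x∈ = trans (filter-accept (_∈? ys ∷ʳ z) (∈-++⁺ˡ x∈))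
                       (cong (x ∷_) (filter-∈?-∷ʳ-fresh ys xs (z∉ ∘ there)))
  ... | no  x∉ = trans (filter-reject (_∈? ys ∷ʳ z) x∉ys∷ʳz) (filter-∈?-∷ʳ-fresh ys xs (z∉ ∘ there))
    where
      x∉ys∷ʳz : x ∉ ys ∷ʳ z
      x∉ys∷ʳz x∈ with ∈-++⁻ ys x∈
      ... | inj₁ x∈ys       = x∉ x∈ys
      ... | inj₂ (here x≡z) = z∉ (here (sym x≡z))

  filter-∈?-∷ʳ-around : ∀ {z} (ys below above : List (Fin n)) → z ∉ below → z ∉ above →
    filter (_∈? ys ∷ʳ z) (below ++ z ∷ above) ≡ filter (_∈? ys) below ++ z ∷ filter (_∈? ys) above
  filter-∈?-∷ʳ-around {z} ys below above z∉below z∉above = begin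
    filter (_∈? ys ∷ʳ z) (below ++ z ∷ above)                      ≡⟨ filter-++ _ below _ ⟩
    filter (_∈? ys ∷ʳ z) below ++ filter (_∈? ys ∷ʳ z) (z ∷ above)  ≡⟨ cong (_ ++_)
                                        (filter-accept (_∈? ys ∷ʳ z) (∈-++⁺ʳ ys (here refl))) ⟩
    filter (_∈? ys ∷ʳ z) below ++ z ∷ filter (_∈? ys ∷ʳ z) above    ≡⟨ cong₂ (λ A R → A ++ z ∷ R)
                                                     (filter-∈?-∷ʳ-fresh ys below z∉below)
                                                     (filter-∈?-∷ʳ-fresh ys above z∉above) ⟩
    filter (_∈? ys) below ++ z ∷ filter (_∈? ys) above              ∎
    where open ≡-Reasoning

  sort-∷ʳ : ∀ {z} (ys : List (Fin n)) → z ∉ ys → ∃₂ λ A R →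
    sort (ys ∷ʳ z) ≡ A ++ z ∷ R × sort ys ≡ A ++ R ×
    (∀ {w} → w ∈ R → w ∈ ys × z < w) × (∀ {y} → y ∈ ys → z < y → y ∈ R)
  sort-∷ʳ {z} ys z∉ys with below , above , eq , below<z , z<above ← allFin-splitAt z =
    filter (_∈? ys) below , filter (_∈? ys) above ,
    trans (cong (filter _) eq) (filter-∈?-∷ʳ-around ys below above
      (λ z∈below → <-irrefl refl (All.lookup below<z z∈below))
      (λ z∈above → <-irrefl refl (All.lookup z<above z∈above))) ,
    trans (cong (filter _) eq) (trans (filter-++ (_∈? ys) below _)
      (cong (filter (_∈? ys) below ++_) (filter-reject (_∈? ys) z∉ys))) ,
    (λ w∈R → let w∈above , w∈ys = ∈-filter⁻ (_∈? ys) w∈R in w∈ys , All.lookup z<above w∈above) ,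
    λ y∈ys z<y → ∈-filter⁺ (_∈? ys) (inAbove y∈ys z<y) y∈ys
    where
      inAbove : ∀ {y} → y ∈ ys → z < y → y ∈ above
      inAbove {y} y∈ys z<y with ∈-++⁻ below (subst (y ∈_) eq (∈-allFin y))
      ... | inj₁ y∈below       = ⊥-elim (<-asym z<y (All.lookup below<z y∈below))
      ... | inj₂ (here refl)   = ⊥-elim (<-irrefl refl z<y)
      ... | inj₂ (there y∈abv) = y∈abv

  -- nonLTRFrom (reverse ys) [ z ] is 1 if z is not a left-to-right maximum of ys ∷ʳ z, else 0.
  sort-∷ʳ-Jumps : ∀ {z} (ys : List (Fin n)) → z ∉ ys →
                  Jumps (nonLTRFrom (reverse ys) [ z ]) (sort (ys ∷ʳ z)) (sort ys ∷ʳ z)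
  sort-∷ʳ-Jumps {z} ys z∉ys with sort-∷ʳ ys z∉ys | all? (_≤? z) (reverse ys)
  ... | A , [] , e₁ , e₂ , _ , _ | yes _ rewrite e₁ | e₂ | ++-identityʳ A = done
  ... | A , w ∷ B , e₁ , e₂ , _ , _ | no _ rewrite e₁ | e₂ = step (RightJump-toEnd A z w B) done
  ... | A , w ∷ B , _ , _ , R⊆ys , _ | yes ys≤z
    with w∈ys , z<w ← R⊆ys (here refl) = ⊥-elim (<⇒≱ z<w (All.lookup ys≤z (Any.reverse⁺ w∈ys)))
  ... | A , [] , _ , _ , _ , ys>z⊆R | no ys≰z
    with y , y∈ys , y≰z ← find (All.¬All⇒Any¬ (_≤? z) (reverse ys) ys≰z)
    with () ← ys>z⊆R (Any.reverse⁻ y∈ys) (≰⇒> y≰z)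

  sort-Jumps : ∀ {xs : List (Fin n)} → Reverse xs → Unique xs → Jumps (nonLTR xs) (sort xs) xs
  sort-Jumps [] _ = subst (λ l → Jumps 0 l []) sort-[] done
    where
      sort-[] : [] ≡ sort []
      sort-[] = sym (filter-none (_∈? []) {allFin n} (All.tabulate (λ _ ())))
  sort-Jumps (ys ∶ r ∶ʳ z) u with ys≢ , _ , ys≢z ← AllPairs-++⁻ ys u =
    subst (λ k → Jumps k (sort (ys ∷ʳ z)) (ys ∷ʳ z)) count
      (sort-∷ʳ-Jumps ys z∉ys ◅◅ Jumps-++ʳ [ z ] (sort-Jumps r ys≢))
    where
      z∉ys : z ∉ ys
      z∉ys z∈ys = All.head (All.lookup ys≢z z∈ys) refl
      count : nonLTRFrom (reverse ys) [ z ] + nonLTR ys ≡ nonLTR (ys ∷ʳ z)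
      count = trans (+-comm _ (nonLTR ys)) (sym (nonLTRFrom-++ [] ys [ z ]))

  oneLine-unique : (τ : Permutation′ n) → Unique (oneLine τ)
  oneLine-unique τ =
    Unique.tabulate⁺ (λ e → trans (sym (inverseˡ τ)) (trans (cong (τ ⟨$⟩ˡ_) e) (inverseˡ τ)))

  sort-oneLine : (τ : Permutation′ n) → sort (oneLine τ) ≡ allFin n
  sort-oneLine τ = filter-all (_∈? oneLine τ)
    (All.tabulate (λ {v} _ → subst (_∈ oneLine τ) (inverseʳ τ) (∈-tabulate⁺ (τ ⟨$⟩ˡ v))))

  insertionSort-oneLine : (τ : Permutation′ n) → Jumps (t τ) (allFin n) (oneLine τ)
  insertionSort-oneLine τ = subst (λ l → Jumps (t τ) l (oneLine τ)) (sort-oneLine τ)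
                              (sort-Jumps (reverseView (oneLine τ)) (oneLine-unique τ))

insertionSort : ∀ {n} (σ : Permutation′ n) → Jumps (t (flip σ)) (oneLine σ) (oneLine (id {n}))
insertionSort σ = subst (Jumps _ (oneLine σ)) (oneLine-·-flip σ)
                    (Jumps-· σ {id} {flip σ} (insertionSort-oneLine (flip σ)))

corollary1 : (n : ℕ) (σ π : Permutation′ n) →
    ((m : ℕ) → Jumps m (oneLine σ) (oneLine π) → t (flip σ · π) ≤ m)
    × ((m : ℕ) → Jumps m (oneLine σ) (oneLine (id {n})) → t (flip σ) ≤ m)
    × Jumps (t (flip σ)) (oneLine σ) (oneLine (id {n}))
corollary1 n σ π = (λ _ → t-lowerBound σ π) , (λ _ → t-lowerBound σ id) , insertionSort σ
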